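{- Let $M=(E,r_M)$ be a $q$-matroid, let $E'\ge E$ be an $\mathbb{F}_q$-vector space with $\dim E'=\dim E+1$, let $N=(E',r_N)$ be a $q$-matroid whose restriction to $E$ is $M$, and let $e\in[E']_q\setminus[E]_q$. Let $$\mathcal{M}=\{F\in\mathcal{F}_M : F+e\in\mathcal{F}_N \text{ and } r_N(F+e)=r_N(F)\}.$$ Then: (M1) if $F\in\mathcal{M}$ and $F'$ is a flat of $M$ containing $F$, then $F'\in\mathcal{M}$; (M2) if $F_1,F_2\in\mathcal{M}$ and $(F_1,F_2)$ is a modular pair of $M$, then $F_1\cap F_2\in\mathcal{M}$.
   Context: $q$ is a prime power. For a finite-dimensional $\mathbb{F}_q$-vector space $E$, $\mathcal{L}(E)$ is the set of subspaces and $[E]_q$ the set of one-dimensional subspaces. A $q$-matroid is a pair $(E,r)$ with $r:\mathcal{L}(E)\to\mathbb{Z}_{\ge0}$ satisfying (R1) $0\le r(X)\le\dim X$; (R2) $X\le Y\Rightarrow r(X)\le r(Y)$; (R3) $r(X+Y)+r(X\cap Y)\le r(X)+r(Y)$. The restriction of $(E',r)$ to a subspace $E$ is $(E,r|_{\mathcal{L}(E)})$. A flat of $(E,r)$ is a subspace $F$ with $r(F+x)>r(F)$ for all $x\in[E]_q\setminus[F]_q$; $\mathcal{F}_M$ is the set of flats of $M$. A pair $(F_1,F_2)$ of flats of $M=(E,r)$ is a modular pair if $r(F_1+F_2)+r(F_1\cap F_2)=r(F_1)+r(F_2)$. -}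

module Defs where

open import Level using (Level; _⊔_) renaming (suc to lsuc)
open import Algebra.Bundles using (CommutativeRing)
open import Data.Nat using (ℕ; zero; suc; _≤_; _<_) renaming (_+_ to _+ℕ_)
open import Data.Fin using (Fin) renaming (zero to fzero; suc to fsuc)
open import Data.List using (List)
open import Data.List.Relation.Unary.Any using (Any)
open import Data.Product using (Σ; ∃; _×_; _,_)
open import Relation.Nullary using (¬_)
open import Relation.Binary.PropositionalEquality using (_≡_)

-- Every finite field
-- is 𝔽_q for a prime power q, so this is "𝔽_q for some prime power q".

record FiniteField (c ℓ : Level) : Set (lsuc (c ⊔ ℓ)) where
  field
    commRing : CommutativeRing c ℓ
  open CommutativeRing commRing public
  field
    1≉0      : ¬ (1# ≈ 0#)
    inverse  : ∀ x → ¬ (x ≈ 0#) → Σ Carrier λ y → (x * y) ≈ 1#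
    elements : List Carrier
    complete : ∀ x → Any (x ≈_) elements

-- Subspaces of the coordinate space 𝔽_q^m.  Every finite-dimensional
-- 𝔽_q-space is (isomorphic to) a subspace of some 𝔽_q^m.

module Linear {c ℓ} (K : FiniteField c ℓ) (m : ℕ) where
  open FiniteField K

  V : Set c
  V = Fin m → Carrier

  _≋_ : V → V → Set ℓ
  u ≋ v = ∀ i → u i ≈ v i

  𝟎 : V
  𝟎 _ = 0#

  _⊕_ : V → V → V
  (u ⊕ v) i = u i + v i

  _·_ : Carrier → V → V
  (k · v) i = k * v i

  lin : ∀ d → (Fin d → Carrier) → (Fin d → V) → V
  lin zero    c v = 𝟎
  lin (suc d) c v = (c fzero · v fzero) ⊕ lin d (λ i → c (fsuc i)) (λ i → v (fsuc i))

  record Subspace : Set (lsuc (c ⊔ ℓ)) where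
    field
      mem  : V → Set (c ⊔ ℓ)
      resp : ∀ {u v} → u ≋ v → mem u → mem v
      0∈   : mem 𝟎
      +∈   : ∀ {u v} → mem u → mem v → mem (u ⊕ v)
      ·∈   : ∀ k {v} → mem v → mem (k · v)
  open Subspace public

  _≤ₛ_ : Subspace → Subspace → Set (c ⊔ ℓ)
  X ≤ₛ Y = ∀ v → mem X v → mem Y v

  _∩ₛ_ : Subspace → Subspace → Subspace
  mem  (X ∩ₛ Y) v = mem X v × mem Y v
  resp (X ∩ₛ Y) e (a , b) = resp X e a , resp Y e b
  0∈   (X ∩ₛ Y) = 0∈ X , 0∈ Y
  +∈   (X ∩ₛ Y) (a , b) (a' , b') = +∈ X a a' , +∈ Y b b'
  ·∈   (X ∩ₛ Y) k (a , b) = ·∈ X k a , ·∈ Y k b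

  Independent : ∀ d → (Fin d → V) → Set (c ⊔ ℓ)
  Independent d b = ∀ cs → lin d cs b ≋ 𝟎 → ∀ i → cs i ≈ 0#

  IsBasis : Subspace → ∀ d → (Fin d → V) → Set (c ⊔ ℓ)
  IsBasis X d b = (∀ i → mem X (b i)) × Independent d b
                × (∀ v → mem X v → Σ (Fin d → Carrier) λ cs → v ≋ lin d cs b)

  HasDim : Subspace → ℕ → Set (c ⊔ ℓ)
  HasDim X d = Σ (Fin d → V) (IsBasis X d)

  -- one-dimensional subspaces, i.e. elements of [X]_q when ≤ X
  OneDim : Subspace → Set (c ⊔ ℓ)
  OneDim X = HasDim X 1

module Sums {c ℓ} (K : FiniteField c ℓ) (m : ℕ) where
  open FiniteField K
  open Linear K m
  open import Relation.Binary.Reasoning.Setoid setoid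

  private
    ⊕-cong : ∀ {a b a' b'} → a ≋ a' → b ≋ b' → (a ⊕ b) ≋ (a' ⊕ b')
    ⊕-cong p q i = +-cong (p i) (q i)

  _+ₛ_ : Subspace → Subspace → Subspace
  mem  (X +ₛ Y) v = Σ V λ a → Σ V λ b → mem X a × mem Y b × v ≋ (a ⊕ b)
  resp (X +ₛ Y) {u} {v} e (a , b , x , y , p) =
    a , b , x , y , λ i → trans (sym (e i)) (p i)
  0∈   (X +ₛ Y) = 𝟎 , 𝟎 , 0∈ X , 0∈ Y , λ i → sym (+-identityʳ 0#)
  +∈   (X +ₛ Y) {u} {v} (a , b , x , y , p) (a' , b' , x' , y' , p') =
    (a ⊕ a') , (b ⊕ b') , +∈ X x x' , +∈ Y y y' , λ i → begin
      u i + v i              ≈⟨ +-cong (p i) (p' i) ⟩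
      (a i + b i) + (a' i + b' i) ≈⟨ +-assoc (a i) (b i) _ ⟩
      a i + (b i + (a' i + b' i)) ≈⟨ +-congˡ (sym (+-assoc (b i) (a' i) (b' i))) ⟩
      a i + ((b i + a' i) + b' i) ≈⟨ +-congˡ (+-congʳ (+-comm (b i) (a' i))) ⟩
      a i + ((a' i + b i) + b' i) ≈⟨ +-congˡ (+-assoc (a' i) (b i) (b' i)) ⟩
      a i + (a' i + (b i + b' i)) ≈⟨ sym (+-assoc (a i) (a' i) _) ⟩
      (a i + a' i) + (b i + b' i) ∎
  ·∈   (X +ₛ Y) k {v} (a , b , x , y , p) =
    (k · a) , (k · b) , ·∈ X k x , ·∈ Y k y , λ i → trans (*-congˡ (p i)) (distribˡ k (a i) (b i))

-- q-matroids.  A q-matroid on the ground space G (a subspace of 𝔽_q^m)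
-- is given by a rank function r on subspaces; only its values on
-- subspaces X ≤ G are relevant (values elsewhere are junk).

module QMatroid {c ℓ} (K : FiniteField c ℓ) (m : ℕ) where
  open Linear K m
  open Sums K m

  record IsQMatroid (G : Subspace) (r : Subspace → ℕ) : Set (lsuc (c ⊔ ℓ)) where
    field
      -- (R1)  0 ≤ r X ≤ dim X   (0 ≤ r X is automatic in ℕ)
      R1 : ∀ X → X ≤ₛ G → ∀ d → HasDim X d → r X ≤ d
      R2 : ∀ X Y → X ≤ₛ G → Y ≤ₛ G → X ≤ₛ Y → r X ≤ r Y
      R3 : ∀ X Y → X ≤ₛ G → Y ≤ₛ G → r (X +ₛ Y) +ℕ r (X ∩ₛ Y) ≤ r X +ℕ r Y

  IsFlat : Subspace → (Subspace → ℕ) → Subspace → Set (lsuc (c ⊔ ℓ))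
  IsFlat G r F = F ≤ₛ G × (∀ x → OneDim x → x ≤ₛ G → ¬ (x ≤ₛ F) → r F < r (F +ₛ x))

  ModularPair : Subspace → (Subspace → ℕ) → Subspace → Subspace → Set (lsuc (c ⊔ ℓ))
  ModularPair G r F₁ F₂ = IsFlat G r F₁ × IsFlat G r F₂
                        × (r (F₁ +ₛ F₂) +ℕ r (F₁ ∩ₛ F₂) ≡ r F₁ +ℕ r F₂)

  InCal : (E E' : Subspace) (rM rN : Subspace → ℕ) (e : Subspace) → Subspace → Set (lsuc (c ⊔ ℓ))
  InCal E E' rM rN e F = IsFlat E rM F × IsFlat E' rN (F +ₛ e) × (rN (F +ₛ e) ≡ rN F)

module Submission where

-- The rank statements are submodularity: for F ≤ F′, r(F′+e) + r F ≤ r F′ + r(F+e) = r F′ + r F, and for a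
-- modular pair r(F₁+F₂) + r(F₁∩F₂+e) ≤ r(F₁+e) + r(F₂+e) = r F₁ + r F₂ = r(F₁+F₂) + r(F₁∩F₂).
-- Flatness of F′+e: the dimension count gives E′ = E + e, so a line x ≰ F′+e contains a vector w + z with
-- z ∈ e and w ∈ E outside F′, and F′ already gains rank from w.  Since e ∩ E = 0, (F₁∩F₂)+e is the
-- intersection of the flats F₁+e and F₂+e, hence a flat.
-- Membership in a subspace is not decidable, so these arguments run under double negation; this suffices
-- because flatness is a strict inequality of ranks.

open import Defs
open import Level using (Level; _⊔_)
open import Data.Nat using (ℕ; zero; suc; _<?_) renaming (_+_ to _+ℕ_; _≤_ to _≤ℕ_)
open import Data.Nat.Properties
  using (module ≤-Reasoning; ≤-antisym; +-mono-≤; +-monoʳ-≤; +-cancelʳ-≤; +-cancelˡ-≤; <⇒≱; ≮⇒≥)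
open import Data.Fin using (Fin; punchIn) renaming (zero to fzero; suc to fsuc)
open import Data.Product using (Σ; _×_; _,_; proj₁; proj₂)
open import Data.Vec.Functional using (insertAt; _∷_)
open import Data.Vec.Functional.Properties using (insertAt-lookup; insertAt-punchIn)
open import Relation.Nullary using (¬_; yes; no)
open import Relation.Nullary.Negation using (¬¬-map)
open import Relation.Nullary.Decidable using (decidable-stable; ¬¬-excluded-middle)
open import Relation.Binary.PropositionalEquality using (_≡_)
import Relation.Binary.PropositionalEquality as ≡
import Algebra.Properties.Ring as RingProperties
import Algebra.Properties.Semiring.Sum as SemiringSum
import Algebra.Solver.Ring.NaturalCoefficients.Default as NaturalSolver

¬¬-∀-Fin : ∀ {p} n {P : Fin n → Set p} → (∀ i → ¬ ¬ P i) → ¬ ¬ (∀ i → P i)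
¬¬-∀-Fin zero    ¬¬P ¬∀P = ¬∀P λ ()
¬¬-∀-Fin (suc n) ¬¬P ¬∀P =
  ¬¬P fzero λ P₀ → ¬¬-∀-Fin n (λ i → ¬¬P (fsuc i)) λ Pₛ →
  ¬∀P λ { fzero → P₀ ; (fsuc i) → Pₛ i }

¬∀⇒¬¬∃¬-Fin : ∀ {p} n {P : Fin n → Set p} → ¬ (∀ i → P i) → ¬ ¬ (Σ (Fin n) λ i → ¬ P i)
¬∀⇒¬¬∃¬-Fin n ¬∀P ¬∃¬P = ¬¬-∀-Fin n (λ i ¬Pi → ¬∃¬P (i , ¬Pi)) ¬∀P

module FieldProperties {c ℓ} (K : FiniteField c ℓ) where
  open FiniteField K
  open RingProperties ring using (-‿distribˡ-*; -‿distribʳ-*; +-inverseˡ-unique; //-rightDividesʳ)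
  open NaturalSolver commutativeSemiring using (solve; _:=_; _:+_)
  open import Relation.Binary.Reasoning.Setoid setoid

  x≈γ*[c*x] : ∀ {c γ} x → c * γ ≈ 1# → x ≈ γ * (c * x)
  x≈γ*[c*x] {c} {γ} x cγ≈1 = begin
    x             ≈⟨ *-identityˡ x ⟨
    1# * x        ≈⟨ *-congʳ (trans (*-comm γ c) cγ≈1) ⟨
    (γ * c) * x   ≈⟨ *-assoc γ c x ⟩
    γ * (c * x)   ∎

  x*y≈0⇒x≈0 : ∀ {x y γ} → y * γ ≈ 1# → x * y ≈ 0# → x ≈ 0#
  x*y≈0⇒x≈0 {x} {y} {γ} yγ≈1 xy≈0 = begin
    x             ≈⟨ x≈γ*[c*x] x yγ≈1 ⟩
    γ * (y * x)   ≈⟨ *-congˡ (trans (*-comm y x) xy≈0) ⟩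
    γ * 0#        ≈⟨ zeroʳ γ ⟩
    0#            ∎

  c*x+y≈0⇒x≈-γ*y : ∀ {c γ x y} → c * γ ≈ 1# → c * x + y ≈ 0# → x ≈ (- γ) * y
  c*x+y≈0⇒x≈-γ*y {c} {γ} {x} {y} cγ≈1 h = begin
    x             ≈⟨ x≈γ*[c*x] x cγ≈1 ⟩
    γ * (c * x)   ≈⟨ *-congˡ (+-inverseˡ-unique (c * x) y h) ⟩
    γ * (- y)     ≈⟨ -‿distribʳ-* γ y ⟨
    - (γ * y)     ≈⟨ -‿distribˡ-* γ y ⟩
    (- γ) * y     ∎

  x+[-[x*γ]]*c≈0 : ∀ {c γ} x → c * γ ≈ 1# → x + (- (x * γ)) * c ≈ 0#
  x+[-[x*γ]]*c≈0 {c} {γ} x cγ≈1 = begin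
    x + (- (x * γ)) * c   ≈⟨ +-congˡ (-‿distribˡ-* (x * γ) c) ⟨
    x + - ((x * γ) * c)   ≈⟨ +-congˡ (-‿cong (trans (*-assoc x γ c) (*-congˡ (trans (*-comm γ c) cγ≈1)))) ⟩
    x + - (x * 1#)        ≈⟨ +-congˡ (-‿cong (*-identityʳ x)) ⟩
    x + - x               ≈⟨ -‿inverseʳ x ⟩
    0#                    ∎

  x+y≈z+w⇒x-z≈w-y : ∀ {x y z w} → x + y ≈ z + w → x - z ≈ w - y
  x+y≈z+w⇒x-z≈w-y {x} {y} {z} {w} h = begin
    x - z                 ≈⟨ +-congʳ (//-rightDividesʳ y x) ⟨
    ((x + y) - y) - z     ≈⟨ +-congʳ (+-congʳ h) ⟩
    ((z + w) - y) - z     ≈⟨ solve 4 (λ z w y′ z′ → ((z :+ w) :+ y′) :+ z′ := (w :+ y′) :+ (z :+ z′))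
                                     refl z w (- y) (- z) ⟩
    (w - y) + (z - z)     ≈⟨ +-congˡ (-‿inverseʳ z) ⟩
    (w - y) + 0#          ≈⟨ +-identityʳ (w - y) ⟩
    w - y                 ∎

module RowReduction {c ℓ} (K : FiniteField c ℓ) where
  open FiniteField K
  open FieldProperties K
  open SemiringSum semiring using (sum; sum-cong-≋; sum-remove; sum-replicate-zero; ∑-distrib-+; *-distribʳ-sum)
  open import Relation.Binary.Reasoning.Setoid setoid

  Matrix : ℕ → ℕ → Set c
  Matrix r k = Fin r → Fin k → Carrier

  rowComb : ∀ {r k} → (Fin r → Carrier) → Matrix r k → Fin k → Carrier
  rowComb d C i = sum (λ j → d j * C j i)

  RowIndependent : ∀ {r k} → Matrix r k → Set (c ⊔ ℓ)
  RowIndependent C = ∀ d → (∀ i → rowComb d C i ≈ 0#) → ∀ j → ¬ ¬ (d j ≈ 0#)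

  addRowMultiples : ∀ {r k} → Fin (suc r) → (Fin r → Carrier) → Matrix (suc r) k → Matrix r k
  addRowMultiples p μ C j i = C (punchIn p j) i + μ j * C p i

  rowComb-addRowMultiples : ∀ {r k} p μ (C : Matrix (suc r) k) d i →
    rowComb d (addRowMultiples p μ C) i ≈ rowComb (insertAt d p (sum (λ j → d j * μ j))) C i
  rowComb-addRowMultiples p μ C d i = begin
    sum (λ j → d j * (C (punchIn p j) i + μ j * C p i))
      ≈⟨ sum-cong-≋ (λ j → trans (distribˡ (d j) _ _) (+-congˡ (sym (*-assoc (d j) (μ j) (C p i))))) ⟩
    sum (λ j → d j * C (punchIn p j) i + (d j * μ j) * C p i)
      ≈⟨ ∑-distrib-+ (λ j → d j * C (punchIn p j) i) (λ j → (d j * μ j) * C p i) ⟩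
    sum (λ j → d j * C (punchIn p j) i) + sum (λ j → (d j * μ j) * C p i)
      ≈⟨ +-congˡ (*-distribʳ-sum (C p i) (λ j → d j * μ j)) ⟨
    sum (λ j → d j * C (punchIn p j) i) + δ * C p i
      ≈⟨ +-comm _ _ ⟩
    δ * C p i + sum (λ j → d j * C (punchIn p j) i)
      ≈⟨ +-cong (*-congʳ (reflexive (insertAt-lookup d p δ)))
                (sum-cong-≋ λ j → *-congʳ (reflexive (insertAt-punchIn d p δ j))) ⟨
    d′ p * C p i + sum (λ j → d′ (punchIn p j) * C (punchIn p j) i)
      ≈⟨ sum-remove {i = p} (λ t → d′ t * C t i) ⟨
    rowComb d′ C i ∎
    where
    δ = sum (λ j → d j * μ j)
    d′ = insertAt d p δ

  RowIndependent-addRowMultiples : ∀ {r k} p μ (C : Matrix (suc r) k) →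
    RowIndependent C → RowIndependent (addRowMultiples p μ C)
  RowIndependent-addRowMultiples p μ C ind d dC≈0 j =
    ≡.subst (λ x → ¬ ¬ (x ≈ 0#)) (insertAt-punchIn d p δ j)
      (ind (insertAt d p δ) (λ i → trans (sym (rowComb-addRowMultiples p μ C d i)) (dC≈0 i)) (punchIn p j))
    where δ = sum (λ j → d j * μ j)

  RowIndependent-dropZeroColumn : ∀ {r k} (C : Matrix r (suc k)) → (∀ j → C j fzero ≈ 0#) →
    RowIndependent C → RowIndependent (λ j i → C j (fsuc i))
  RowIndependent-dropZeroColumn {r} C zeroColumn ind d dC≈0 = ind d λ
    { fzero → trans (sum-cong-≋ λ j → trans (*-congˡ (zeroColumn j)) (zeroʳ (d j))) (sum-replicate-zero r)
    ; (fsuc i) → dC≈0 i }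

  pivot-clears-column : ∀ {r k} (C : Matrix (suc r) (suc k)) p → ¬ (C p fzero ≈ 0#) →
    Σ (Fin r → Carrier) λ μ → ∀ j → addRowMultiples p μ C j fzero ≈ 0#
  pivot-clears-column C p Cp≉0 =
    (λ j → - (C (punchIn p j) fzero * γ)) , λ j → x+[-[x*γ]]*c≈0 (C (punchIn p j) fzero) Cpγ≈1
    where
    γ = proj₁ (inverse (C p fzero) Cp≉0)
    Cpγ≈1 = proj₂ (inverse (C p fzero) Cp≉0)

  firstColumn-clearable : ∀ {r k} (C : Matrix (suc r) (suc k)) →
    ¬ ¬ (Σ (Fin (suc r)) λ p → Σ (Fin r → Carrier) λ μ → ∀ j → addRowMultiples p μ C j fzero ≈ 0#)
  firstColumn-clearable {r} C done =
    ¬¬-excluded-middle {A = Σ (Fin (suc r)) λ p → ¬ (C p fzero ≈ 0#)} λ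
    { (yes (p , Cp≉0)) → done (p , pivot-clears-column C p Cp≉0)
    ; (no noPivot) → ¬¬-∀-Fin (suc r) {λ p → C p fzero ≈ 0#} (λ p Cp≉0 → noPivot (p , Cp≉0)) λ zeroColumn →
        done (fzero , (λ _ → 0#) , λ j → trans (+-cong (zeroColumn (fsuc j)) (zeroˡ _)) (+-identityʳ 0#)) }

  steinitz : ∀ k (C : Matrix (suc k) k) → ¬ RowIndependent C
  steinitz zero    C ind = ind (λ _ → 1#) (λ ()) fzero 1≉0
  steinitz (suc k) C ind = firstColumn-clearable C λ (p , μ , zeroColumn) →
    steinitz k (λ j i → addRowMultiples p μ C j (fsuc i))
      (RowIndependent-dropZeroColumn (addRowMultiples p μ C) zeroColumn
        (RowIndependent-addRowMultiples p μ C ind))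

module Subspaces {c ℓ} (K : FiniteField c ℓ) (m : ℕ) where
  open FiniteField K
  open RingProperties ring using (-1*x≈-x; x∙y⁻¹≈ε⇒x≈y; //-rightDividesʳ)
  open SemiringSum semiring using (sum; sum-cong-≋; sum-replicate-zero; ∑-comm; *-distribˡ-sum; *-distribʳ-sum)
  open import Relation.Binary.Reasoning.Setoid setoid
  open FieldProperties K
  open RowReduction K
  open Linear K m
  open Sums K m

  ≤ₛ-refl : ∀ X → X ≤ₛ X
  ≤ₛ-refl X v v∈X = v∈X

  ≤ₛ-trans : ∀ X Y Z → X ≤ₛ Y → Y ≤ₛ Z → X ≤ₛ Z
  ≤ₛ-trans X Y Z X≤Y Y≤Z v v∈X = Y≤Z v (X≤Y v v∈X)

  +ₛ-upperˡ : ∀ X Y → X ≤ₛ (X +ₛ Y)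
  +ₛ-upperˡ X Y v v∈X = v , 𝟎 , v∈X , 0∈ Y , λ t → sym (+-identityʳ (v t))

  +ₛ-upperʳ : ∀ X Y → Y ≤ₛ (X +ₛ Y)
  +ₛ-upperʳ X Y v v∈Y = 𝟎 , v , 0∈ X , v∈Y , λ t → sym (+-identityˡ (v t))

  +ₛ-lub : ∀ X Y Z → X ≤ₛ Z → Y ≤ₛ Z → (X +ₛ Y) ≤ₛ Z
  +ₛ-lub X Y Z X≤Z Y≤Z v (a , b , a∈X , b∈Y , v≋a+b) =
    resp Z (λ t → sym (v≋a+b t)) (+∈ Z (X≤Z a a∈X) (Y≤Z b b∈Y))

  +ₛ-mono : ∀ X X′ Y Y′ → X ≤ₛ X′ → Y ≤ₛ Y′ → (X +ₛ Y) ≤ₛ (X′ +ₛ Y′)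
  +ₛ-mono X X′ Y Y′ X≤X′ Y≤Y′ v (a , b , a∈X , b∈Y , v≋a+b) =
    a , b , X≤X′ a a∈X , Y≤Y′ b b∈Y , v≋a+b

  ∩ₛ-lowerˡ : ∀ X Y → (X ∩ₛ Y) ≤ₛ X
  ∩ₛ-lowerˡ X Y v = proj₁

  ∩ₛ-lowerʳ : ∀ X Y → (X ∩ₛ Y) ≤ₛ Y
  ∩ₛ-lowerʳ X Y v = proj₂

  ∩ₛ-glb : ∀ X Y Z → Z ≤ₛ X → Z ≤ₛ Y → Z ≤ₛ (X ∩ₛ Y)
  ∩ₛ-glb X Y Z Z≤X Z≤Y v v∈Z = Z≤X v v∈Z , Z≤Y v v∈Z

  _⊖_ : V → V → V
  (u ⊖ v) t = u t - v t

  ⊖-mem : ∀ X {u v} → mem X u → mem X v → mem X (u ⊖ v)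
  ⊖-mem X u∈X v∈X = resp X (λ t → +-congˡ (-1*x≈-x _)) (+∈ X u∈X (·∈ X (- 1#) v∈X))

  summand-mem : ∀ X {u w z} → u ≋ (w ⊕ z) → mem X u → mem X z → mem X w
  summand-mem X u≋w+z u∈X z∈X =
    resp X (λ t → trans (+-congʳ (u≋w+z t)) (//-rightDividesʳ _ _)) (⊖-mem X u∈X z∈X)

  lin-mem : ∀ X d cs b → (∀ i → mem X (b i)) → mem X (lin d cs b)
  lin-mem X zero    cs b b∈X = 0∈ X
  lin-mem X (suc d) cs b b∈X =
    +∈ X (·∈ X (cs fzero) (b∈X fzero)) (lin-mem X d _ _ (λ i → b∈X (fsuc i)))

  lin≈sum : ∀ d cs b t → lin d cs b t ≈ sum (λ j → cs j * b j t)
  lin≈sum zero    cs b t = refl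
  lin≈sum (suc d) cs b t = +-congˡ (lin≈sum d (λ i → cs (fsuc i)) (λ i → b (fsuc i)) t)

  lin-zero : ∀ d {cs} b → (∀ i → cs i ≈ 0#) → lin d cs b ≋ 𝟎
  lin-zero d {cs} b cs≈0 t = begin
    lin d cs b t              ≈⟨ lin≈sum d cs b t ⟩
    sum (λ j → cs j * b j t)  ≈⟨ sum-cong-≋ (λ j → trans (*-congʳ (cs≈0 j)) (zeroˡ (b j t))) ⟩
    sum {d} (λ _ → 0#)        ≈⟨ sum-replicate-zero d ⟩
    0#                        ∎

  lin-coordinates : ∀ r k (a : Fin r → V) (C : Matrix r k) b →
    (∀ j → a j ≋ lin k (C j) b) → ∀ d → lin r d a ≋ lin k (rowComb d C) b
  lin-coordinates r k a C b a≋Cb d t = begin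
    lin r d a t
      ≈⟨ lin≈sum r d a t ⟩
    sum (λ j → d j * a j t)
      ≈⟨ sum-cong-≋ (λ j → *-congˡ (trans (a≋Cb j t) (lin≈sum k (C j) b t))) ⟩
    sum (λ j → d j * sum (λ i → C j i * b i t))
      ≈⟨ sum-cong-≋ (λ j → *-distribˡ-sum (d j) (λ i → C j i * b i t)) ⟩
    sum (λ j → sum (λ i → d j * (C j i * b i t)))
      ≈⟨ ∑-comm (λ j i → d j * (C j i * b i t)) ⟩
    sum (λ i → sum (λ j → d j * (C j i * b i t)))
      ≈⟨ sum-cong-≋ (λ i → sum-cong-≋ λ j → sym (*-assoc (d j) (C j i) (b i t))) ⟩
    sum (λ i → sum (λ j → (d j * C j i) * b i t))
      ≈⟨ sum-cong-≋ (λ i → *-distribʳ-sum (b i t) (λ j → d j * C j i)) ⟨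
    sum (λ i → rowComb d C i * b i t)
      ≈⟨ lin≈sum k (rowComb d C) b t ⟨
    lin k (rowComb d C) b t ∎

  WeaklyIndependent : ∀ d → (Fin d → V) → Set (c ⊔ ℓ)
  WeaklyIndependent d a = ∀ cs → lin d cs a ≋ 𝟎 → ∀ i → ¬ ¬ (cs i ≈ 0#)

  steinitz-vectors : ∀ k (a : Fin (suc k) → V) (b : Fin k → V) →
    (∀ j → Σ (Fin k → Carrier) λ cs → a j ≋ lin k cs b) → ¬ WeaklyIndependent (suc k) a
  steinitz-vectors k a b a∈⟨b⟩ ind = steinitz k C λ d dC≈0 →
    ind d λ t → trans (lin-coordinates (suc k) k a C b (λ j → proj₂ (a∈⟨b⟩ j)) d t) (lin-zero k b dC≈0 t)
    where
    C : Matrix (suc k) k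
    C j = proj₁ (a∈⟨b⟩ j)

  generator : ∀ x → OneDim x → V
  generator x (g , _) = g fzero

  generator-mem : ∀ x (ox : OneDim x) → mem x (generator x ox)
  generator-mem x (_ , g∈x , _) = g∈x fzero

  generator-spans : ∀ x (ox : OneDim x) {z} → mem x z → Σ Carrier λ k → z ≋ (k · generator x ox)
  generator-spans x (_ , _ , _ , spans) {z} z∈x with spans z z∈x
  ... | cs , z≋ = cs fzero , λ t → trans (z≋ t) (+-identityʳ _)

  oneDim-≤ : ∀ x X (ox : OneDim x) → mem X (generator x ox) → x ≤ₛ X
  oneDim-≤ x X ox g∈X z z∈x with generator-spans x ox z∈x
  ... | k , z≋kg = resp X (λ t → sym (z≋kg t)) (·∈ X k g∈X)

  span : V → Subspace
  mem  (span w) z = Σ Carrier λ k → z ≋ (k · w)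
  resp (span w) u≋v (k , u≋kw) = k , λ t → trans (sym (u≋v t)) (u≋kw t)
  0∈   (span w) = 0# , λ t → sym (zeroˡ (w t))
  +∈   (span w) (k , u≋kw) (k′ , v≋k′w) =
    k + k′ , λ t → trans (+-cong (u≋kw t) (v≋k′w t)) (sym (distribʳ (w t) k k′))
  ·∈   (span w) k′ (k , v≋kw) = k′ * k , λ t → trans (*-congˡ (v≋kw t)) (sym (*-assoc k′ k (w t)))

  ∈-span : ∀ {w} → mem (span w) w
  ∈-span {w} = 1# , λ s → sym (*-identityˡ (w s))

  span-≤ : ∀ X {w} → mem X w → span w ≤ₛ X
  span-≤ X w∈X z (k , z≋kw) = resp X (λ t → sym (z≋kw t)) (·∈ X k w∈X)

  span-OneDim : ∀ w t → ¬ (w t ≈ 0#) → OneDim (span w)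
  span-OneDim w t wₜ≉0 =
    (λ _ → w) , (λ _ → ∈-span) , independent ,
    λ z (k , z≋kw) → (λ _ → k) , λ s → trans (z≋kw s) (sym (+-identityʳ _))
    where
    independent : Independent 1 (λ _ → w)
    independent cs cw≋0 fzero =
      x*y≈0⇒x≈0 (proj₂ (inverse (w t) wₜ≉0)) (trans (sym (+-identityʳ _)) (cw≋0 t))

  oneDim-meets-trivially : ∀ x X → OneDim x → ¬ (x ≤ₛ X) → ∀ z → mem x z → mem X z → ¬ ¬ (z ≋ 𝟎)
  oneDim-meets-trivially x X ox x≰X z z∈x z∈X z≉0 with generator-spans x ox z∈x
  ... | k , z≋kg = x≰X (oneDim-≤ x X ox (resp X g≋γz (·∈ X γ z∈X)))
    where
    k≉0 : ¬ (k ≈ 0#)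
    k≉0 k≈0 = z≉0 λ t → trans (z≋kg t) (trans (*-congʳ k≈0) (zeroˡ _))
    γ = proj₁ (inverse k k≉0)
    g≋γz : (γ · z) ≋ generator x ox
    g≋γz t = sym (trans (x≈γ*[c*x] _ (proj₂ (inverse k k≉0))) (*-congˡ (sym (z≋kg t))))

  mem-of-nonzero-coefficient : ∀ X {c v w} → ¬ (c ≈ 0#) → mem X w → ((c · v) ⊕ w) ≋ 𝟎 → mem X v
  mem-of-nonzero-coefficient X {c} c≉0 w∈X cv+w≋0 =
    resp X (λ t → sym (c*x+y≈0⇒x≈-γ*y (proj₂ (inverse c c≉0)) (cv+w≋0 t))) (·∈ X _ w∈X)

  -- v, the generator u of e and a basis of E are n + 2 vectors of the (n + 1)-dimensional E′, so they are
  -- dependent; in a dependence the coefficient of v cannot vanish, as u ∉ E and the basis is independent.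
  hyperplane-+ₛ-line-spans : ∀ n E E′ e → HasDim E n → HasDim E′ (suc n) → E ≤ₛ E′ →
    OneDim e → e ≤ₛ E′ → ¬ (e ≤ₛ E) → ∀ v → mem E′ v → ¬ ¬ mem (E +ₛ e) v
  hyperplane-+ₛ-line-spans n E E′ e (b , b∈E , b-independent , _) (b′ , _ , _ , b′-spans)
                           E≤E′ oe e≤E′ e≰E v v∈E′ v∉E+e =
    steinitz-vectors (suc n) a b′ (λ j → b′-spans (a j) (a∈E′ j)) independent
    where
    u = generator e oe
    u∈e = generator-mem e oe

    a : Fin (suc (suc n)) → V
    a = v ∷ u ∷ b

    a∈E′ : ∀ j → mem E′ (a j)
    a∈E′ fzero               = v∈E′
    a∈E′ (fsuc fzero)        = e≤E′ u u∈e
    a∈E′ (fsuc (fsuc i))     = E≤E′ (b i) (b∈E i)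

    drop-vanishing : ∀ {k x y} → k ≈ 0# → ((k · x) ⊕ y) ≋ 𝟎 → y ≋ 𝟎
    drop-vanishing {x = x} {y} k≈0 kx+y≋0 t =
      trans (sym (trans (+-congʳ (trans (*-congʳ k≈0) (zeroˡ (x t)))) (+-identityˡ (y t)))) (kx+y≋0 t)

    independent : WeaklyIndependent (suc (suc n)) a
    independent d da≋0 = λ
      { fzero           → dᵥ≈0
      ; (fsuc fzero)    → λ dᵤ≉0 → dᵥ≈0 λ dᵥ≈0′ → dᵤ≈0 dᵥ≈0′ dᵤ≉0
      ; (fsuc (fsuc i)) → λ dᵢ≉0 → dᵥ≈0 λ dᵥ≈0′ → dᵤ≈0 dᵥ≈0′ λ dᵤ≈0′ →
          dᵢ≉0 (b-independent _ (drop-vanishing dᵤ≈0′ (drop-vanishing dᵥ≈0′ da≋0)) i) }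
      where
      L = lin n (λ i → d (fsuc (fsuc i))) b
      L∈E = lin-mem E n _ b b∈E

      dᵥ≈0 : ¬ ¬ (d fzero ≈ 0#)
      dᵥ≈0 dᵥ≉0 = v∉E+e (mem-of-nonzero-coefficient (E +ₛ e) dᵥ≉0
        (L , _ , L∈E , ·∈ e (d (fsuc fzero)) u∈e , λ t → +-comm _ _) da≋0)

      dᵤ≈0 : d fzero ≈ 0# → ¬ ¬ (d (fsuc fzero) ≈ 0#)
      dᵤ≈0 dᵥ≈0′ dᵤ≉0 =
        e≰E (oneDim-≤ e E oe (mem-of-nonzero-coefficient E dᵤ≉0 L∈E (drop-vanishing dᵥ≈0′ da≋0)))

  +ₛ-∩-≤ : ∀ E F₁ F₂ L → F₁ ≤ₛ E → F₂ ≤ₛ E → (∀ z → mem L z → mem E z → ¬ ¬ (z ≋ 𝟎)) →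
    ∀ v → mem (F₁ +ₛ L) v → mem (F₂ +ₛ L) v → ¬ ¬ mem ((F₁ ∩ₛ F₂) +ₛ L) v
  +ₛ-∩-≤ E F₁ F₂ L F₁≤E F₂≤E L∩E≋0 v (a₁ , z₁ , a₁∈F₁ , z₁∈L , v≋a₁+z₁)
                                     (a₂ , z₂ , a₂∈F₂ , z₂∈L , v≋a₂+z₂) =
    ¬¬-map (λ a₁-a₂≋0 → a₁ , z₁ , (a₁∈F₁ , a₁∈F₂ a₁-a₂≋0) , z₁∈L , v≋a₁+z₁)
      (L∩E≋0 (a₁ ⊖ a₂) a₁-a₂∈L (⊖-mem E (F₁≤E a₁ a₁∈F₁) (F₂≤E a₂ a₂∈F₂)))
    where
    a₁-a₂∈L : mem L (a₁ ⊖ a₂)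
    a₁-a₂∈L = resp L (λ t → sym (x+y≈z+w⇒x-z≈w-y (trans (sym (v≋a₁+z₁ t)) (v≋a₂+z₂ t))))
                (⊖-mem L z₂∈L z₁∈L)

    a₁∈F₂ : (a₁ ⊖ a₂) ≋ 𝟎 → mem F₂ a₁
    a₁∈F₂ a₁-a₂≋0 = resp F₂ (λ t → sym (x∙y⁻¹≈ε⇒x≈y _ _ (a₁-a₂≋0 t))) a₂∈F₂

module Flats {c ℓ} (K : FiniteField c ℓ) (m : ℕ) where
  open FiniteField K using (sym)
  open Linear K m
  open Sums K m
  open QMatroid K m
  open Subspaces K m
  open ≤-Reasoning

  module _ (G : Subspace) (r : Subspace → ℕ) where

    IsFlat-intro : ∀ F → F ≤ₛ G →
      (∀ x → OneDim x → x ≤ₛ G → r (F +ₛ x) ≤ℕ r F → ¬ ¬ (x ≤ₛ F)) → IsFlat G r F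
    IsFlat-intro F F≤G closed = F≤G , λ x ox x≤G x≰F →
      decidable-stable (r F <? r (F +ₛ x)) λ r[F+x]≯rF → closed x ox x≤G (≮⇒≥ r[F+x]≯rF) x≰F

    IsFlat-absorbs : ∀ F x → IsFlat G r F → OneDim x → x ≤ₛ G → r (F +ₛ x) ≤ℕ r F → ¬ ¬ (x ≤ₛ F)
    IsFlat-absorbs F x (_ , F-flat) ox x≤G r[F+x]≤rF x≰F = <⇒≱ (F-flat x ox x≤G x≰F) r[F+x]≤rF

    IsFlat-absorbs-vector : ∀ F w → IsFlat G r F → mem G w → r (F +ₛ span w) ≤ℕ r F → ¬ ¬ mem F w
    IsFlat-absorbs-vector F w F-flat w∈G r[F+w]≤rF w∉F =
      ¬∀⇒¬¬∃¬-Fin m (λ w≋0 → w∉F (resp F (λ t → sym (w≋0 t)) (0∈ F))) λ (t , wₜ≉0) →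
      IsFlat-absorbs F (span w) F-flat (span-OneDim w t wₜ≉0) (span-≤ G w∈G) r[F+w]≤rF λ ⟨w⟩≤F →
      w∉F (⟨w⟩≤F w ∈-span)

  module _ {G : Subspace} {r : Subspace → ℕ} (M : IsQMatroid G r) where
    open IsQMatroid M

    submodular-≤ : ∀ A B X Y → A ≤ₛ G → B ≤ₛ G → X ≤ₛ (A +ₛ B) → Y ≤ₛ (A ∩ₛ B) →
      r X +ℕ r Y ≤ℕ r A +ℕ r B
    submodular-≤ A B X Y A≤G B≤G X≤A+B Y≤A∩B = begin
      r X +ℕ r Y
        ≤⟨ +-mono-≤ (R2 X (A +ₛ B) (≤ₛ-trans X (A +ₛ B) G X≤A+B A+B≤G) A+B≤G X≤A+B)
                    (R2 Y (A ∩ₛ B) (≤ₛ-trans Y (A ∩ₛ B) G Y≤A∩B A∩B≤G) A∩B≤G Y≤A∩B) ⟩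
      r (A +ₛ B) +ℕ r (A ∩ₛ B)
        ≤⟨ R3 A B A≤G B≤G ⟩
      r A +ℕ r B ∎
      where
      A+B≤G = +ₛ-lub A B G A≤G B≤G
      A∩B≤G = ≤ₛ-trans (A ∩ₛ B) A G (∩ₛ-lowerˡ A B) A≤G

    rank-+ₛ-≡ : ∀ X Y → X ≤ₛ G → Y ≤ₛ G → r (X +ₛ Y) ≤ℕ r X → r (X +ₛ Y) ≡ r X
    rank-+ₛ-≡ X Y X≤G Y≤G r[X+Y]≤rX =
      ≤-antisym r[X+Y]≤rX (R2 X (X +ₛ Y) X≤G (+ₛ-lub X Y G X≤G Y≤G) (+ₛ-upperˡ X Y))

    rank-absorption : ∀ F H x → F ≤ₛ G → H ≤ₛ F → x ≤ₛ G → r (H +ₛ x) ≤ℕ r H → r (F +ₛ x) ≤ℕ r F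
    rank-absorption F H x F≤G H≤F x≤G r[H+x]≤rH = +-cancelʳ-≤ (r H) _ _ (begin
      r (F +ₛ x) +ℕ r H   ≤⟨ submodular-≤ F (H +ₛ x) (F +ₛ x) H F≤G
                               (+ₛ-lub H x G (≤ₛ-trans H F G H≤F F≤G) x≤G)
                               (+ₛ-mono F F x (H +ₛ x) (≤ₛ-refl F) (+ₛ-upperʳ H x))
                               (∩ₛ-glb F (H +ₛ x) H H≤F (+ₛ-upperˡ H x)) ⟩
      r F +ℕ r (H +ₛ x)   ≤⟨ +-monoʳ-≤ (r F) r[H+x]≤rH ⟩
      r F +ℕ r H          ∎)

    IsFlat-meet : ∀ F₁ F₂ H → IsFlat G r F₁ → IsFlat G r F₂ → H ≤ₛ F₁ → H ≤ₛ F₂ →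
      (∀ v → mem F₁ v → mem F₂ v → ¬ ¬ mem H v) → IsFlat G r H
    IsFlat-meet F₁ F₂ H F₁-flat@(F₁≤G , _) F₂-flat@(F₂≤G , _) H≤F₁ H≤F₂ F₁∩F₂≤H =
      IsFlat-intro G r H (≤ₛ-trans H F₁ G H≤F₁ F₁≤G) λ x ox x≤G r[H+x]≤rH x≰H →
      IsFlat-absorbs G r F₁ x F₁-flat ox x≤G (rank-absorption F₁ H x F₁≤G H≤F₁ x≤G r[H+x]≤rH) λ x≤F₁ →
      IsFlat-absorbs G r F₂ x F₂-flat ox x≤G (rank-absorption F₂ H x F₂≤G H≤F₂ x≤G r[H+x]≤rH) λ x≤F₂ →
      F₁∩F₂≤H (generator x ox) (x≤F₁ _ (generator-mem x ox)) (x≤F₂ _ (generator-mem x ox)) λ g∈H →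
      x≰H (oneDim-≤ x H ox g∈H)

    IsFlat-∩ : ∀ F₁ F₂ → IsFlat G r F₁ → IsFlat G r F₂ → IsFlat G r (F₁ ∩ₛ F₂)
    IsFlat-∩ F₁ F₂ F₁-flat F₂-flat =
      IsFlat-meet F₁ F₂ (F₁ ∩ₛ F₂) F₁-flat F₂-flat (∩ₛ-lowerˡ F₁ F₂) (∩ₛ-lowerʳ F₁ F₂)
        λ v v∈F₁ v∈F₂ v∉F₁∩F₂ → v∉F₁∩F₂ (v∈F₁ , v∈F₂)

module Extension {c ℓ} (K : FiniteField c ℓ) (m : ℕ) where
  open Linear K m
  open Sums K m
  open QMatroid K m
  open Subspaces K m
  open Flats K m
  open ≤-Reasoning

  module _ (E E′ : Subspace) (rM rN : Subspace → ℕ) (e : Subspace) (N : IsQMatroid E′ rN)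
           (rM≗rN : ∀ X → X ≤ₛ E → rM X ≡ rN X) (E≤E′ : E ≤ₛ E′) (e≤E′ : e ≤ₛ E′) where
    open IsQMatroid N

    InCal-upward : (∀ v → mem E′ v → ¬ ¬ mem (E +ₛ e) v) →
      ∀ F F′ → InCal E E′ rM rN e F → IsFlat E rM F′ → F ≤ₛ F′ → InCal E E′ rM rN e F′
    InCal-upward E′≤E+e F F′ ((F≤E , _) , _ , r[F+e]≡rF) F′-flat@(F′≤E , _) F≤F′ =
      F′-flat , IsFlat-intro E′ rN (F′ +ₛ e) F′+e≤E′ closed , r[F′+e]≡rF′
      where
      F≤E′ = ≤ₛ-trans F E E′ F≤E E≤E′
      F′≤E′ = ≤ₛ-trans F′ E E′ F′≤E E≤E′
      F′+e≤E′ = +ₛ-lub F′ e E′ F′≤E′ e≤E′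

      r[F′+e]≡rF′ : rN (F′ +ₛ e) ≡ rN F′
      r[F′+e]≡rF′ = rank-+ₛ-≡ N F′ e F′≤E′ e≤E′ (+-cancelʳ-≤ (rN F) _ _ (begin
        rN (F′ +ₛ e) +ℕ rN F        ≤⟨ submodular-≤ N F′ (F +ₛ e) (F′ +ₛ e) F
                                         F′≤E′ (+ₛ-lub F e E′ F≤E′ e≤E′)
                                         (+ₛ-mono F′ F′ e (F +ₛ e) (≤ₛ-refl F′) (+ₛ-upperʳ F e))
                                         (∩ₛ-glb F′ (F +ₛ e) F F≤F′ (+ₛ-upperˡ F e)) ⟩
        rN F′ +ℕ rN (F +ₛ e)        ≡⟨ ≡.cong (rN F′ +ℕ_) r[F+e]≡rF ⟩
        rN F′ +ℕ rN F               ∎))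

      closed : ∀ x → OneDim x → x ≤ₛ E′ → rN ((F′ +ₛ e) +ₛ x) ≤ℕ rN (F′ +ₛ e) → ¬ ¬ (x ≤ₛ (F′ +ₛ e))
      closed x ox x≤E′ no-increase x≰F′+e =
        E′≤E+e g (x≤E′ g (generator-mem x ox)) λ (w , z , w∈E , z∈e , g≋w+z) →
        IsFlat-absorbs-vector E rM F′ w F′-flat w∈E (rank-bound w w∈E z z∈e g≋w+z) λ w∈F′ →
        x≰F′+e (oneDim-≤ x (F′ +ₛ e) ox (w , z , w∈F′ , z∈e , g≋w+z))
        where
        g = generator x ox
        F′+e+x = (F′ +ₛ e) +ₛ x

        rank-bound : ∀ w → mem E w → ∀ z → mem e z → g ≋ (w ⊕ z) → rM (F′ +ₛ span w) ≤ℕ rM F′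
        rank-bound w w∈E z z∈e g≋w+z = begin
          rM (F′ +ₛ span w)   ≡⟨ rM≗rN (F′ +ₛ span w) F′+w≤E ⟩
          rN (F′ +ₛ span w)   ≤⟨ R2 (F′ +ₛ span w) F′+e+x (≤ₛ-trans (F′ +ₛ span w) E E′ F′+w≤E E≤E′)
                                    (+ₛ-lub (F′ +ₛ e) x E′ F′+e≤E′ x≤E′) F′+w≤F′+e+x ⟩
          rN F′+e+x           ≤⟨ no-increase ⟩
          rN (F′ +ₛ e)        ≡⟨ r[F′+e]≡rF′ ⟩
          rN F′               ≡⟨ rM≗rN F′ F′≤E ⟨
          rM F′               ∎
          where
          F′+w≤E = +ₛ-lub F′ (span w) E F′≤E (span-≤ E w∈E)

          w∈F′+e+x : mem F′+e+x w
          w∈F′+e+x = summand-mem F′+e+x g≋w+z (+ₛ-upperʳ (F′ +ₛ e) x g (generator-mem x ox))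
                       (+ₛ-upperˡ (F′ +ₛ e) x z (+ₛ-upperʳ F′ e z z∈e))

          F′+w≤F′+e+x : (F′ +ₛ span w) ≤ₛ F′+e+x
          F′+w≤F′+e+x = +ₛ-lub F′ (span w) F′+e+x
            (≤ₛ-trans F′ (F′ +ₛ e) F′+e+x (+ₛ-upperˡ F′ e) (+ₛ-upperˡ (F′ +ₛ e) x))
            (span-≤ F′+e+x w∈F′+e+x)

    InCal-∩ : IsQMatroid E rM → (∀ z → mem e z → mem E z → ¬ ¬ (z ≋ 𝟎)) →
      ∀ F₁ F₂ → InCal E E′ rM rN e F₁ → InCal E E′ rM rN e F₂ → ModularPair E rM F₁ F₂ →
      InCal E E′ rM rN e (F₁ ∩ₛ F₂)
    InCal-∩ M e∩E≋0 F₁ F₂ (F₁-flat@(F₁≤E , _) , F₁+e-flat , r[F₁+e]≡rF₁)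
                          (F₂-flat@(F₂≤E , _) , F₂+e-flat , r[F₂+e]≡rF₂) (_ , _ , modular) =
        IsFlat-∩ M F₁ F₂ F₁-flat F₂-flat
      , IsFlat-meet N (F₁ +ₛ e) (F₂ +ₛ e) (H +ₛ e) F₁+e-flat F₂+e-flat H+e≤F₁+e H+e≤F₂+e
          (+ₛ-∩-≤ E F₁ F₂ e F₁≤E F₂≤E e∩E≋0)
      , r[H+e]≡rH
      where
      H = F₁ ∩ₛ F₂
      H≤E = ≤ₛ-trans H F₁ E (∩ₛ-lowerˡ F₁ F₂) F₁≤E
      H+e≤F₁+e = +ₛ-mono H F₁ e e (∩ₛ-lowerˡ F₁ F₂) (≤ₛ-refl e)
      H+e≤F₂+e = +ₛ-mono H F₂ e e (∩ₛ-lowerʳ F₁ F₂) (≤ₛ-refl e)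

      +e≤E′ : ∀ X → X ≤ₛ E → (X +ₛ e) ≤ₛ E′
      +e≤E′ X X≤E = +ₛ-lub X e E′ (≤ₛ-trans X E E′ X≤E E≤E′) e≤E′

      r[H+e]≡rH : rN (H +ₛ e) ≡ rN H
      r[H+e]≡rH = rank-+ₛ-≡ N H e (≤ₛ-trans H E E′ H≤E E≤E′) e≤E′
                    (+-cancelˡ-≤ (rN (F₁ +ₛ F₂)) _ _ (begin
        rN (F₁ +ₛ F₂) +ℕ rN (H +ₛ e)   ≤⟨ submodular-≤ N (F₁ +ₛ e) (F₂ +ₛ e) (F₁ +ₛ F₂) (H +ₛ e)
                                             (+e≤E′ F₁ F₁≤E) (+e≤E′ F₂ F₂≤E)
                                             (+ₛ-mono F₁ (F₁ +ₛ e) F₂ (F₂ +ₛ e) (+ₛ-upperˡ F₁ e) (+ₛ-upperˡ F₂ e))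
                                             (∩ₛ-glb (F₁ +ₛ e) (F₂ +ₛ e) (H +ₛ e) H+e≤F₁+e H+e≤F₂+e) ⟩
        rN (F₁ +ₛ e) +ℕ rN (F₂ +ₛ e)   ≡⟨ ≡.cong₂ _+ℕ_ r[F₁+e]≡rF₁ r[F₂+e]≡rF₂ ⟩
        rN F₁ +ℕ rN F₂                 ≡⟨ ≡.cong₂ _+ℕ_ (rM≗rN F₁ F₁≤E) (rM≗rN F₂ F₂≤E) ⟨
        rM F₁ +ℕ rM F₂                 ≡⟨ modular ⟨
        rM (F₁ +ₛ F₂) +ℕ rM H          ≡⟨ ≡.cong₂ _+ℕ_ (rM≗rN (F₁ +ₛ F₂) (+ₛ-lub F₁ F₂ E F₁≤E F₂≤E))
                                                        (rM≗rN H H≤E) ⟩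
        rN (F₁ +ₛ F₂) +ℕ rN H          ∎))

lemma3p2 : ∀ {c ℓ : Level} (K : FiniteField c ℓ) (m n : ℕ) →
    let open Linear K m
        open Sums K m
        open QMatroid K m
    in (E E' : Subspace) (rM rN : Subspace → ℕ) (e : Subspace) →
    HasDim E n → HasDim E' (suc n) → E ≤ₛ E' →
    IsQMatroid E rM → IsQMatroid E' rN →
    (∀ X → X ≤ₛ E → rM X ≡ rN X) →
    OneDim e → e ≤ₛ E' → ¬ (e ≤ₛ E) →
    (∀ F F' → InCal E E' rM rN e F → IsFlat E rM F' → F ≤ₛ F' → InCal E E' rM rN e F')
    ×
    (∀ F₁ F₂ → InCal E E' rM rN e F₁ → InCal E E' rM rN e F₂ → ModularPair E rM F₁ F₂ →
       InCal E E' rM rN e (F₁ ∩ₛ F₂))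
lemma3p2 K m n E E′ rM rN e dimE dimE′ E≤E′ M N rM≗rN oe e≤E′ e≰E =
    InCal-upward E E′ rM rN e N rM≗rN E≤E′ e≤E′
      (hyperplane-+ₛ-line-spans n E E′ e dimE dimE′ E≤E′ oe e≤E′ e≰E)
  , InCal-∩ E E′ rM rN e N rM≗rN E≤E′ e≤E′ M (oneDim-meets-trivially e E oe e≰E)
  where
  open Subspaces K m
  open Extension K m
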